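{- Let $V(x)=\sum_{n\ge1}v(n)x^n$, where $v(n)$ is the total number of vertices summed over all Schroeder trees with $n$ leaves. Then, as formal power series, $$V(x)=\frac{3-x+\sqrt{1-6x+x^2}}{4\sqrt{1-6x+x^2}}\left(\frac{2x}{1+x+\sqrt{1-6x+x^2}}\right).$$
   Context: A Schroeder tree is a rooted planar (ordered) tree in which every non-leaf vertex has at least two children; its size is its number of leaves. The square root denotes the formal power series with constant term $1$. -}

module Defs where

open import Data.Nat as ℕ using (ℕ; zero; suc; _∸_)
open import Data.List using (List; []; _∷_; map; foldr; upTo)
open import Data.Integer using (+_; -[1+_])
open import Data.Rational as ℚ using (ℚ; 0ℚ; 1ℚ; _/_)
open import Relation.Binary.PropositionalEquality using (_≡_)

-- An internal node stores its first two children and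
-- the (possibly empty) ordered list of remaining children.

data STree : Set where
  leaf : STree
  node : STree → STree → List STree → STree

mutual
  leaves : STree → ℕ
  leaves leaf = 1
  leaves (node a b ts) = leaves a ℕ.+ leaves b ℕ.+ leavesL ts

  leavesL : List STree → ℕ
  leavesL [] = 0
  leavesL (t ∷ ts) = leaves t ℕ.+ leavesL ts

mutual
  vertices : STree → ℕ
  vertices leaf = 1
  vertices (node a b ts) = suc (vertices a ℕ.+ vertices b ℕ.+ verticesL ts)

  verticesL : List STree → ℕ
  verticesL [] = 0
  verticesL (t ∷ ts) = vertices t ℕ.+ verticesL ts

sumℕ : List ℕ → ℕ
sumℕ = foldr ℕ._+_ 0

FPS : Set
FPS = ℕ → ℚ

_≈_ : FPS → FPS → Set
f ≈ g = ∀ n → f n ≡ g n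
infix 4 _≈_

sumℚ : List ℚ → ℚ
sumℚ = foldr ℚ._+_ 0ℚ

_⊕_ : FPS → FPS → FPS
(f ⊕ g) n = f n ℚ.+ g n
infixl 6 _⊕_

_⊖_ : FPS → FPS → FPS
(f ⊖ g) n = f n ℚ.- g n
infixl 6 _⊖_

_⊛_ : FPS → FPS → FPS
(f ⊛ g) n = sumℚ (map (λ k → f k ℚ.* g (n ∸ k)) (upTo (suc n)))
infixl 7 _⊛_

const : ℚ → FPS
const c zero = c
const c (suc n) = 0ℚ

X : FPS
X 1 = 1ℚ
X _ = 0ℚ

ℚof : ℕ → ℚ
ℚof n = (+ n) / 1

P : FPS
P = const 1ℚ ⊖ const (ℚof 6) ⊛ X ⊕ X ⊛ X

Vseries : (ℕ → List STree) → FPS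
Vseries enum n = ℚof (sumℕ (map vertices (enum n)))

-- Cutting a Schroeder tree at its root gives, for the counting series T and F of trees and
-- forests (by number of leaves) and the vertex-counting series V and W,
--   T = x + T²F,   F = 1 + TF,   V = x + (T² + 2TV)F + T²W,   W = VF + TW.
-- Eliminating F and W gives 2T² − (1 + x)T + x = 0 and V(1 + x − 4T) = T(1 − T). The first
-- makes (1 + x − 4T)² = 1 − 6x + x², so 1 + x − 4T is the square root S (series with an
-- invertible constant term are not zero divisors); then T = 2x/(1 + x + S) and
-- V = T(1 − T)/S = (3 − x + S)T/(4S). The series are computed from an explicit enumeration
-- of trees; any other duplicate-free enumeration is a permutation of it.
module Submission where

open import Defs
open import Level using (0ℓ)
open import Function.Base using (_∘_)
open import Function.Bundles using (_⇔_; mk⇔)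
import Function.Properties.Equivalence as ⇔
open import Data.Nat as ℕ using (ℕ; zero; suc; _∸_; _≤_; _<_; z≤n; s≤s)
import Data.Nat.Properties as ℕP
import Data.Nat.ListAction.Properties as ℕL
open import Data.Nat.Solver renaming (module +-*-Solver to ℕ-Solver)
import Data.Nat.Coprimality as Coprime
open import Data.Integer as ℤ using (+_)
import Data.Integer.Properties as ℤP
open import Data.Rational as ℚ using (ℚ; 0ℚ; 1ℚ; mkℚ)
import Data.Rational.Properties as ℚP
open import Data.Rational.Solver using (module +-*-Solver)
open import Data.Maybe using (Maybe; just; nothing)
open import Data.Product using (∃; ∃₂; _×_; _,_; proj₁; uncurry)
open import Data.Product.Properties using (,-injective)
open import Data.Sum using (inj₁; inj₂)
open import Data.List using (List; []; _∷_; _++_; map; upTo; concatMap; cartesianProductWith)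
import Data.List.Properties as List
import Data.List.Relation.Unary.All as All
import Data.List.Relation.Unary.All.Properties as All
open import Data.List.Relation.Unary.All using ([])
import Data.List.Relation.Unary.AllPairs as AllPairs
import Data.List.Relation.Unary.AllPairs.Properties as AllPairs
open import Data.List.Relation.Unary.AllPairs using ([]; _∷_)
open import Data.List.Relation.Unary.Any using (here)
open import Data.List.Membership.Propositional using (_∈_; find; lose)
open import Data.List.Membership.Propositional.Properties
  using (∈-upTo⁺; ∈-upTo⁻; ∈-++⁻; ∈-++⁺ʳ; ∈-concatMap⁺; ∈-concatMap⁻;
         ∈-cartesianProductWith⁺; ∈-cartesianProductWith⁻)
open import Data.List.Membership.Propositional.Properties.WithK using (unique∧set⇒bag)
open import Data.List.Relation.Unary.Unique.Propositional using (Unique)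
import Data.List.Relation.Unary.Unique.Propositional.Properties as Unique
open import Data.List.Relation.Binary.Disjoint.Propositional using (Disjoint)
import Data.List.Relation.Binary.Permutation.Propositional.Properties as Perm
open import Data.List.Relation.Binary.BagAndSetEquality using (∼bag⇒↭)
open import Relation.Binary.PropositionalEquality
open import Relation.Nullary using (yes; no; contradiction)
open import Algebra.Bundles using (CommutativeRing; CommutativeMonoid)
open import Algebra.Structures using (IsCommutativeRing)
import Algebra.Construct.Pointwise ℕ as Pointwise
import Algebra.Properties.CommutativeSemigroup as CommutativeSemigroup
import Algebra.Solver.Ring.AlmostCommutativeRing as ACR
import Algebra.Solver.Ring
import Relation.Binary.Reasoning.Setoid as SetoidReasoning

module ℕ+ = CommutativeSemigroup ℕP.+-commutativeSemigroup
module ℚ+ = CommutativeSemigroup (CommutativeMonoid.commutativeSemigroup ℚP.+-0-commutativeMonoid)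

ℚof≡mkℚ : ∀ n → ℚof n ≡ mkℚ (+ n) 0 (Coprime.sym (Coprime.1-coprimeTo n))
ℚof≡mkℚ n = ℚP.normalize-coprime (Coprime.sym (Coprime.1-coprimeTo n))

ℚof-+ : ∀ m n → ℚof (m ℕ.+ n) ≡ ℚof m ℚ.+ ℚof n
ℚof-+ m n = sym (trans (cong₂ ℚ._+_ (ℚof≡mkℚ m) (ℚof≡mkℚ n))
  (cong (ℚ._/ 1) (cong₂ ℤ._+_ (ℤP.*-identityʳ (+ m)) (ℤP.*-identityʳ (+ n)))))

ℚof-* : ∀ m n → ℚof (m ℕ.* n) ≡ ℚof m ℚ.* ℚof n
ℚof-* m n = sym (trans (cong₂ ℚ._*_ (ℚof≡mkℚ m) (ℚof≡mkℚ n)) (cong (ℚ._/ 1) (sym (ℤP.pos-* m n))))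

ℚof-sum : ∀ (a : ℕ → ℕ) ks → ℚof (sumℕ (map a ks)) ≡ sumℚ (map (ℚof ∘ a) ks)
ℚof-sum a []       = refl
ℚof-sum a (k ∷ ks) = trans (ℚof-+ (a k) (sumℕ (map a ks))) (cong (ℚof (a k) ℚ.+_) (ℚof-sum a ks))

sumℚ-map-+ : ∀ (a b : ℕ → ℚ) ks → sumℚ (map (λ k → a k ℚ.+ b k) ks) ≡ sumℚ (map a ks) ℚ.+ sumℚ (map b ks)
sumℚ-map-+ a b []       = refl
sumℚ-map-+ a b (k ∷ ks) = trans (cong (a k ℚ.+ b k ℚ.+_) (sumℚ-map-+ a b ks))
  (ℚ+.interchange (a k) (b k) (sumℚ (map a ks)) (sumℚ (map b ks)))

sumℚ-map-*ˡ : ∀ c (a : ℕ → ℚ) ks → sumℚ (map (λ k → c ℚ.* a k) ks) ≡ c ℚ.* sumℚ (map a ks)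
sumℚ-map-*ˡ c a []       = sym (ℚP.*-zeroʳ c)
sumℚ-map-*ˡ c a (k ∷ ks) = trans (cong (c ℚ.* a k ℚ.+_) (sumℚ-map-*ˡ c a ks))
  (sym (ℚP.*-distribˡ-+ c (a k) (sumℚ (map a ks))))

-- Formal power series as a commutative ring

0ˢ 1ˢ : FPS
0ˢ _ = 0ℚ
1ˢ = const 1ℚ

neg : FPS → FPS
neg f n = ℚ.- f n

scale : ℚ → FPS → FPS
scale c f n = c ℚ.* f n

shift : FPS → FPS
shift f n = f (suc n)

⊛-suc : ∀ f g n → (f ⊛ g) (suc n) ≡ f 0 ℚ.* g (suc n) ℚ.+ (shift f ⊛ g) n
⊛-suc f g n = cong (f 0 ℚ.* g (suc n) ℚ.+_) (trans
  (cong sumℚ (List.map-applyUpTo suc (λ k → f k ℚ.* g (suc n ∸ k)) (suc n)))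
  (sym (cong sumℚ (List.map-upTo (λ k → shift f k ℚ.* g (n ∸ k)) (suc n)))))

⊛-sucʳ : ∀ f g n → (f ⊛ g) (suc n) ≡ (f ⊛ shift g) n ℚ.+ f (suc n) ℚ.* g 0
⊛-sucʳ f g zero = solve 4 (λ a b c d → a :* d :+ (c :* b :+ con 0ℚ) := a :* d :+ con 0ℚ :+ c :* b)
  refl (f 0) (g 0) (f 1) (g 1)
  where open +-*-Solver
⊛-sucʳ f g (suc n) = begin
    (f ⊛ g) (suc (suc n))
  ≡⟨ ⊛-suc f g (suc n) ⟩
    f 0 ℚ.* g (suc (suc n)) ℚ.+ (shift f ⊛ g) (suc n)
  ≡⟨ cong (f 0 ℚ.* g (suc (suc n)) ℚ.+_) (⊛-sucʳ (shift f) g n) ⟩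
    f 0 ℚ.* g (suc (suc n)) ℚ.+ ((shift f ⊛ shift g) n ℚ.+ f (suc (suc n)) ℚ.* g 0)
  ≡⟨ ℚP.+-assoc (f 0 ℚ.* g (suc (suc n))) ((shift f ⊛ shift g) n) (f (suc (suc n)) ℚ.* g 0) ⟨
    f 0 ℚ.* g (suc (suc n)) ℚ.+ (shift f ⊛ shift g) n ℚ.+ f (suc (suc n)) ℚ.* g 0
  ≡⟨ cong (ℚ._+ f (suc (suc n)) ℚ.* g 0) (⊛-suc f (shift g) n) ⟨
    (f ⊛ shift g) (suc n) ℚ.+ f (suc (suc n)) ℚ.* g 0
  ∎
  where open ≡-Reasoning

⊛-cong : ∀ {f f′ g g′} → f ≈ f′ → g ≈ g′ → f ⊛ g ≈ f′ ⊛ g′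
⊛-cong f≈f′ g≈g′ n =
  cong sumℚ (List.map-cong (λ k → cong₂ ℚ._*_ (f≈f′ k) (g≈g′ (n ∸ k))) (upTo (suc n)))

⊛-congʳ : ∀ h {f g} → f ≈ g → f ⊛ h ≈ g ⊛ h
⊛-congʳ h f≈g = ⊛-cong {g = h} f≈g (λ _ → refl)

⊕-congˡ : ∀ f {g h} → g ≈ h → f ⊕ g ≈ f ⊕ h
⊕-congˡ f g≈h n = cong (f n ℚ.+_) (g≈h n)

⊛-comm : ∀ f g → f ⊛ g ≈ g ⊛ f
⊛-comm f g zero    = cong (ℚ._+ 0ℚ) (ℚP.*-comm (f 0) (g 0))
⊛-comm f g (suc n) = begin
  (f ⊛ g) (suc n)                         ≡⟨ ⊛-suc f g n ⟩
  f 0 ℚ.* g (suc n) ℚ.+ (shift f ⊛ g) n   ≡⟨ cong₂ ℚ._+_ (ℚP.*-comm (f 0) (g (suc n)))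
                                                            (⊛-comm (shift f) g n) ⟩
  g (suc n) ℚ.* f 0 ℚ.+ (g ⊛ shift f) n   ≡⟨ ℚP.+-comm (g (suc n) ℚ.* f 0) ((g ⊛ shift f) n) ⟩
  (g ⊛ shift f) n ℚ.+ g (suc n) ℚ.* f 0   ≡⟨ ⊛-sucʳ g f n ⟨
  (g ⊛ f) (suc n)                         ∎
  where open ≡-Reasoning

⊛-zeroˡ : ∀ f → 0ˢ ⊛ f ≈ 0ˢ
⊛-zeroˡ f zero    = trans (ℚP.+-identityʳ (0ℚ ℚ.* f 0)) (ℚP.*-zeroˡ (f 0))
⊛-zeroˡ f (suc n) = trans (⊛-suc 0ˢ f n)
  (trans (cong₂ ℚ._+_ (ℚP.*-zeroˡ (f (suc n))) (⊛-zeroˡ f n)) (ℚP.+-identityʳ 0ℚ))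

⊛-zeroʳ : ∀ f → f ⊛ 0ˢ ≈ 0ˢ
⊛-zeroʳ f n = trans (⊛-comm f 0ˢ n) (⊛-zeroˡ f n)

⊛-identityˡ : ∀ f → 1ˢ ⊛ f ≈ f
⊛-identityˡ f zero    = trans (ℚP.+-identityʳ (1ℚ ℚ.* f 0)) (ℚP.*-identityˡ (f 0))
⊛-identityˡ f (suc n) = trans (⊛-suc 1ˢ f n)
  (trans (cong₂ ℚ._+_ (ℚP.*-identityˡ (f (suc n))) (⊛-zeroˡ f n)) (ℚP.+-identityʳ (f (suc n))))

⊛-identityʳ : ∀ f → f ⊛ 1ˢ ≈ f
⊛-identityʳ f n = trans (⊛-comm f 1ˢ n) (⊛-identityˡ f n)

⊛-distribˡ-⊕ : ∀ f g h → f ⊛ (g ⊕ h) ≈ f ⊛ g ⊕ f ⊛ h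
⊛-distribˡ-⊕ f g h n = trans
  (cong sumℚ (List.map-cong (λ k → ℚP.*-distribˡ-+ (f k) (g (n ∸ k)) (h (n ∸ k))) (upTo (suc n))))
  (sumℚ-map-+ (λ k → f k ℚ.* g (n ∸ k)) (λ k → f k ℚ.* h (n ∸ k)) (upTo (suc n)))

⊛-distribʳ-⊕ : ∀ h f g → (f ⊕ g) ⊛ h ≈ f ⊛ h ⊕ g ⊛ h
⊛-distribʳ-⊕ h f g n = begin
  ((f ⊕ g) ⊛ h) n     ≡⟨ ⊛-comm (f ⊕ g) h n ⟩
  (h ⊛ (f ⊕ g)) n     ≡⟨ ⊛-distribˡ-⊕ h f g n ⟩
  (h ⊛ f ⊕ h ⊛ g) n   ≡⟨ cong₂ ℚ._+_ (⊛-comm h f n) (⊛-comm h g n) ⟩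
  (f ⊛ h ⊕ g ⊛ h) n   ∎
  where open ≡-Reasoning

⊛-scaleˡ : ∀ c f g → scale c f ⊛ g ≈ scale c (f ⊛ g)
⊛-scaleˡ c f g n = trans
  (cong sumℚ (List.map-cong (λ k → ℚP.*-assoc c (f k) (g (n ∸ k))) (upTo (suc n))))
  (sumℚ-map-*ˡ c (λ k → f k ℚ.* g (n ∸ k)) (upTo (suc n)))

⊛-assoc : ∀ f g h → (f ⊛ g) ⊛ h ≈ f ⊛ (g ⊛ h)
⊛-assoc f g h zero = solve 3 (λ a b c → (a :* b :+ con 0ℚ) :* c :+ con 0ℚ := a :* (b :* c :+ con 0ℚ) :+ con 0ℚ)
  refl (f 0) (g 0) (h 0)
  where open +-*-Solver
⊛-assoc f g h (suc n) = begin
    ((f ⊛ g) ⊛ h) (suc n)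
  ≡⟨ ⊛-suc (f ⊛ g) h n ⟩
    (f ⊛ g) 0 ℚ.* h (suc n) ℚ.+ (shift (f ⊛ g) ⊛ h) n
  ≡⟨ cong ((f ⊛ g) 0 ℚ.* h (suc n) ℚ.+_) shifted ⟩
    (f 0 ℚ.* g 0 ℚ.+ 0ℚ) ℚ.* h (suc n) ℚ.+ (f 0 ℚ.* (shift g ⊛ h) n ℚ.+ (shift f ⊛ (g ⊛ h)) n)
  ≡⟨ solve 5 (λ a b c d e → (a :* b :+ con 0ℚ) :* c :+ (a :* d :+ e) := a :* (b :* c :+ d) :+ e)
       refl (f 0) (g 0) (h (suc n)) ((shift g ⊛ h) n) ((shift f ⊛ (g ⊛ h)) n) ⟩
    f 0 ℚ.* (g 0 ℚ.* h (suc n) ℚ.+ (shift g ⊛ h) n) ℚ.+ (shift f ⊛ (g ⊛ h)) n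
  ≡⟨ cong (λ z → f 0 ℚ.* z ℚ.+ (shift f ⊛ (g ⊛ h)) n) (⊛-suc g h n) ⟨
    f 0 ℚ.* (g ⊛ h) (suc n) ℚ.+ (shift f ⊛ (g ⊛ h)) n
  ≡⟨ ⊛-suc f (g ⊛ h) n ⟨
    (f ⊛ (g ⊛ h)) (suc n)
  ∎
  where
  open ≡-Reasoning
  open +-*-Solver
  shifted : (shift (f ⊛ g) ⊛ h) n ≡ f 0 ℚ.* (shift g ⊛ h) n ℚ.+ (shift f ⊛ (g ⊛ h)) n
  shifted = begin
    (shift (f ⊛ g) ⊛ h) n                             ≡⟨ ⊛-cong {g = h} (⊛-suc f g) (λ _ → refl) n ⟩
    ((scale (f 0) (shift g) ⊕ shift f ⊛ g) ⊛ h) n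
      ≡⟨ ⊛-distribʳ-⊕ h (scale (f 0) (shift g)) (shift f ⊛ g) n ⟩
    (scale (f 0) (shift g) ⊛ h ⊕ shift f ⊛ g ⊛ h) n
      ≡⟨ cong₂ ℚ._+_ (⊛-scaleˡ (f 0) (shift g) h n) (⊛-assoc (shift f) g h n) ⟩
    f 0 ℚ.* (shift g ⊛ h) n ℚ.+ (shift f ⊛ (g ⊛ h)) n ∎

⊕-⊛-isCommutativeRing : IsCommutativeRing _≈_ _⊕_ _⊛_ neg 0ˢ 1ˢ
⊕-⊛-isCommutativeRing = record
  { isRing = record
    { +-isAbelianGroup = Pointwise.isAbelianGroup ℚP.+-0-isAbelianGroup
    ; *-cong           = ⊛-cong
    ; *-assoc          = ⊛-assoc
    ; *-identity       = ⊛-identityˡ , ⊛-identityʳ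
    ; distrib          = ⊛-distribˡ-⊕ , ⊛-distribʳ-⊕
    }
  ; *-comm = ⊛-comm
  }

⊕-⊛-commutativeRing : CommutativeRing 0ℓ 0ℓ
⊕-⊛-commutativeRing = record { isCommutativeRing = ⊕-⊛-isCommutativeRing }

module FPS = CommutativeRing ⊕-⊛-commutativeRing

const-⊕ : ∀ a b → const (a ℚ.+ b) ≈ const a ⊕ const b
const-⊕ a b zero    = refl
const-⊕ a b (suc n) = refl

const-⊛ : ∀ a b → const (a ℚ.* b) ≈ const a ⊛ const b
const-⊛ a b zero    = sym (ℚP.+-identityʳ (a ℚ.* b))
const-⊛ a b (suc n) = sym (trans (⊛-suc (const a) (const b) n)
  (trans (cong₂ ℚ._+_ (ℚP.*-zeroʳ a) (⊛-zeroˡ (const b) n)) (ℚP.+-identityʳ 0ℚ)))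

const-neg : ∀ a → const (ℚ.- a) ≈ neg (const a)
const-neg a zero    = refl
const-neg a (suc n) = refl

const-0 : const 0ℚ ≈ 0ˢ
const-0 zero    = refl
const-0 (suc n) = refl

const-homomorphism : ℚP.+-*-rawRing ACR.-Raw-AlmostCommutative⟶ ACR.fromCommutativeRing ⊕-⊛-commutativeRing
const-homomorphism = record
  { ⟦_⟧ = const ; +-homo = const-⊕ ; *-homo = const-⊛ ; -‿homo = const-neg
  ; 0-homo = const-0 ; 1-homo = λ _ → refl }

const-≟ : ∀ a b → Maybe (const a ≈ const b)
const-≟ a b with a ℚP.≟ b
... | yes refl = just (λ _ → refl)
... | no _     = nothing

module FPS-Solver = Algebra.Solver.Ring ℚP.+-*-rawRing
  (ACR.fromCommutativeRing ⊕-⊛-commutativeRing) const-homomorphism const-≟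

-- Consequences of equations aᵢ ≈ bᵢ are proved by writing the difference of the two sides as
-- Σ cᵢ ⊛ (aᵢ ⊖ bᵢ); the ring solver checks that identity.
vanishes : ∀ c {a b} → a ≈ b → c ⊛ (a ⊖ b) ≈ 0ˢ
vanishes c {a} {b} a≈b n = trans
  (⊛-cong {f = c} (λ _ → refl) (λ k → trans (cong (ℚ._- b k) (a≈b k)) (ℚP.+-inverseʳ (b k))) n)
  (⊛-zeroʳ c n)

vanishes₀ : ∀ c {q} → q ≈ 0ˢ → c ⊛ q ≈ 0ˢ
vanishes₀ c q≈0 n = trans (⊛-cong {f = c} (λ _ → refl) q≈0 n) (⊛-zeroʳ c n)

infixl 5 _⊞_
_⊞_ : ∀ {p q} → p ≈ 0ˢ → q ≈ 0ˢ → p ⊕ q ≈ 0ˢ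
(p≈0 ⊞ q≈0) n = trans (cong₂ ℚ._+_ (p≈0 n) (q≈0 n)) (ℚP.+-identityʳ 0ℚ)

linear-combination : ∀ {l r z} → z ≈ 0ˢ → l ≈ r ⊕ z → l ≈ r
linear-combination {r = r} z≈0 l≈r⊕z n =
  trans (l≈r⊕z n) (trans (cong (r n ℚ.+_) (z≈0 n)) (ℚP.+-identityʳ (r n)))

-- Agreement up to a degree, and cancellation

infix 4 _≈[≤_]_
_≈[≤_]_ : FPS → ℕ → FPS → Set
f ≈[≤ n ] g = ∀ {k} → k ≤ n → f k ≡ g k

⊕-cong-≤ : ∀ {n f f′ g g′} → f ≈[≤ n ] f′ → g ≈[≤ n ] g′ → f ⊕ g ≈[≤ n ] f′ ⊕ g′
⊕-cong-≤ f≈f′ g≈g′ k≤n = cong₂ ℚ._+_ (f≈f′ k≤n) (g≈g′ k≤n)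

⊛-cong-≤ : ∀ {n f f′ g g′} → f ≈[≤ n ] f′ → g ≈[≤ n ] g′ → f ⊛ g ≈[≤ n ] f′ ⊛ g′
⊛-cong-≤ f≈f′ g≈g′ {k} k≤n = cong sumℚ (List.map-cong-local (All.tabulate λ {i} i∈ →
  cong₂ ℚ._*_ (f≈f′ (ℕP.≤-trans (ℕP.≤-pred (∈-upTo⁻ i∈)) k≤n)) (g≈g′ (ℕP.≤-trans (ℕP.m∸n≤m k i) k≤n))))

p*q≡0⇒p≡0 : ∀ p q → q ≢ 0ℚ → p ℚ.* q ≡ 0ℚ → p ≡ 0ℚ
p*q≡0⇒p≡0 p q q≢0 pq≡0 = begin
  p                      ≡⟨ ℚP.*-identityʳ p ⟨
  p ℚ.* 1ℚ               ≡⟨ cong (p ℚ.*_) (ℚP.*-inverseʳ q) ⟨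
  p ℚ.* (q ℚ.* ℚ.1/ q)   ≡⟨ ℚP.*-assoc p q (ℚ.1/ q) ⟨
  p ℚ.* q ℚ.* ℚ.1/ q     ≡⟨ cong (ℚ._* ℚ.1/ q) pq≡0 ⟩
  0ℚ ℚ.* ℚ.1/ q          ≡⟨ ℚP.*-zeroˡ (ℚ.1/ q) ⟩
  0ℚ                     ∎
  where open ≡-Reasoning
        instance _ = ℚ.≢-nonZero q≢0

p+p≡0⇒p≡0 : ∀ p → p ℚ.+ p ≡ 0ℚ → p ≡ 0ℚ
p+p≡0⇒p≡0 p p+p≡0 = p*q≡0⇒p≡0 p (1ℚ ℚ.+ 1ℚ) (λ ()) (trans (ℚP.*-distribˡ-+ p 1ℚ 1ℚ)
  (trans (cong₂ ℚ._+_ (ℚP.*-identityʳ p) (ℚP.*-identityʳ p)) p+p≡0))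

f⊛g≈0⇒f≈0 : ∀ {f g} → g 0 ≢ 0ℚ → f ⊛ g ≈ 0ˢ → f ≈ 0ˢ
f⊛g≈0⇒f≈0 {f} {g} g₀≢0 fg≈0 n = vanishes-upto n ℕP.≤-refl
  where
  vanishes-upto : ∀ n → f ≈[≤ n ] 0ˢ
  vanishes-upto zero z≤n = p*q≡0⇒p≡0 (f 0) (g 0) g₀≢0 (trans (sym (ℚP.+-identityʳ _)) (fg≈0 0))
  vanishes-upto (suc n) {k} k≤1+n with k ℕP.≟ suc n
  ... | no k≢1+n = vanishes-upto n (ℕP.≤-pred (ℕP.≤∧≢⇒< k≤1+n k≢1+n))
  ... | yes refl = p*q≡0⇒p≡0 (f (suc n)) (g 0) g₀≢0 (begin
    f (suc n) ℚ.* g 0                       ≡⟨ ℚP.+-identityˡ _ ⟨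
    0ℚ ℚ.+ f (suc n) ℚ.* g 0                ≡⟨ cong (ℚ._+ f (suc n) ℚ.* g 0) lower-terms ⟨
    (f ⊛ shift g) n ℚ.+ f (suc n) ℚ.* g 0   ≡⟨ ⊛-sucʳ f g n ⟨
    (f ⊛ g) (suc n)                         ≡⟨ fg≈0 (suc n) ⟩
    0ℚ                                      ∎)
    where
    open ≡-Reasoning
    lower-terms : (f ⊛ shift g) n ≡ 0ℚ
    lower-terms = trans (⊛-cong-≤ {g = shift g} (vanishes-upto n) (λ _ → refl) ℕP.≤-refl) (⊛-zeroˡ (shift g) n)

-- Generating functions of enumerations

total : ∀ {A : Set} → (A → ℕ) → List A → ℕ
total w xs = sumℕ (map w xs)

count : ∀ {A : Set} → List A → ℕ
count = total (λ _ → 1)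

total-++ : ∀ {A : Set} (w : A → ℕ) xs ys → total w (xs ++ ys) ≡ total w xs ℕ.+ total w ys
total-++ w xs ys = trans (cong sumℕ (List.map-++ w xs ys)) (ℕL.sum-++ (map w xs) (map w ys))

total-+ : ∀ {A : Set} (u v : A → ℕ) xs → total (λ x → u x ℕ.+ v x) xs ≡ total u xs ℕ.+ total v xs
total-+ u v []       = refl
total-+ u v (x ∷ xs) = trans (cong (u x ℕ.+ v x ℕ.+_) (total-+ u v xs))
  (ℕ+.interchange (u x) (v x) (total u xs) (total v xs))

total-const : ∀ {A : Set} a (xs : List A) → total (λ _ → a) xs ≡ a ℕ.* count xs
total-const a []       = sym (ℕP.*-zeroʳ a)
total-const a (x ∷ xs) = trans (cong (a ℕ.+_) (total-const a xs)) (sym (ℕP.*-suc a (count xs)))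

total-map : ∀ {A B : Set} (w : B → ℕ) (g : A → B) xs → total w (map g xs) ≡ total (w ∘ g) xs
total-map w g xs = cong sumℕ (sym (List.map-∘ xs))

total-concatMap : ∀ {A B : Set} (w : B → ℕ) (g : A → List B) xs →
                  total w (concatMap g xs) ≡ total (total w ∘ g) xs
total-concatMap w g []       = refl
total-concatMap w g (x ∷ xs) =
  trans (total-++ w (g x) (concatMap g xs)) (cong (total w (g x) ℕ.+_) (total-concatMap w g xs))

total-unique : ∀ {A : Set} (w : A → ℕ) {xs ys : List A} → Unique xs → Unique ys →
               (∀ {z} → z ∈ xs ⇔ z ∈ ys) → total w xs ≡ total w ys
total-unique w xs! ys! xs⇔ys = ℕL.sum-↭ (Perm.map⁺ w (∼bag⇒↭ (unique∧set⇒bag xs! ys! xs⇔ys)))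

module _ {A B C : Set} (c : A → B → C) where

  count-cartesianProductWith : ∀ xs ys → count (cartesianProductWith c xs ys) ≡ count xs ℕ.* count ys
  count-cartesianProductWith []       ys = refl
  count-cartesianProductWith (x ∷ xs) ys = trans (total-++ _ (map (c x) ys) (cartesianProductWith c xs ys))
    (cong₂ ℕ._+_ (total-map _ (c x) ys) (count-cartesianProductWith xs ys))

  total-cartesianProductWith : ∀ {w : C → ℕ} {u : A → ℕ} {v : B → ℕ} → (∀ x y → w (c x y) ≡ u x ℕ.+ v y) →
    ∀ xs ys → total w (cartesianProductWith c xs ys) ≡ total u xs ℕ.* count ys ℕ.+ count xs ℕ.* total v ys
  total-cartesianProductWith w≡u+v [] ys = refl
  total-cartesianProductWith {w} {u} {v} w≡u+v (x ∷ xs) ys = begin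
    total w (map (c x) ys ++ cartesianProductWith c xs ys)
      ≡⟨ total-++ w (map (c x) ys) (cartesianProductWith c xs ys) ⟩
    total w (map (c x) ys) ℕ.+ total w (cartesianProductWith c xs ys)
      ≡⟨ cong₂ ℕ._+_ row (total-cartesianProductWith w≡u+v xs ys) ⟩
    (u x ℕ.* count ys ℕ.+ total v ys) ℕ.+ (total u xs ℕ.* count ys ℕ.+ count xs ℕ.* total v ys)
      ≡⟨ solve 5 (λ a b c d e → (a :* b :+ c) :+ (d :* b :+ e :* c) := (a :+ d) :* b :+ (con 1 :+ e) :* c)
           refl (u x) (count ys) (total v ys) (total u xs) (count xs) ⟩
    total u (x ∷ xs) ℕ.* count ys ℕ.+ count (x ∷ xs) ℕ.* total v ys ∎
    where
    open ≡-Reasoning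
    open ℕ-Solver
    row : total w (map (c x) ys) ≡ u x ℕ.* count ys ℕ.+ total v ys
    row = begin
      total w (map (c x) ys)                ≡⟨ total-map w (c x) ys ⟩
      total (w ∘ c x) ys                    ≡⟨ cong sumℕ (List.map-cong (w≡u+v x) ys) ⟩
      total (λ y → u x ℕ.+ v y) ys          ≡⟨ total-+ (λ _ → u x) v ys ⟩
      total (λ _ → u x) ys ℕ.+ total v ys   ≡⟨ cong (ℕ._+ total v ys) (total-const (u x) ys) ⟩
      u x ℕ.* count ys ℕ.+ total v ys       ∎

ℚof-convolution : ∀ (a b : ℕ → ℕ) n →
  ℚof (sumℕ (map (λ k → a k ℕ.* b (n ∸ k)) (upTo (suc n)))) ≡ ((ℚof ∘ a) ⊛ (ℚof ∘ b)) n
ℚof-convolution a b n = trans (ℚof-sum (λ k → a k ℕ.* b (n ∸ k)) (upTo (suc n)))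
  (cong sumℚ (List.map-cong (λ k → ℚof-* (a k) (b (n ∸ k))) (upTo (suc n))))

infixl 7 _⋆⟨_⟩_
_⋆⟨_⟩_ : ∀ {A B C : Set} → (ℕ → List A) → (A → B → C) → (ℕ → List B) → ℕ → List C
(E ⋆⟨ c ⟩ F) n = concatMap (λ k → cartesianProductWith c (E k) (F (n ∸ k))) (upTo (suc n))

weightGF : ∀ {A : Set} → (A → ℕ) → (ℕ → List A) → FPS
weightGF w E n = ℚof (total w (E n))

countGF : ∀ {A : Set} → (ℕ → List A) → FPS
countGF = weightGF (λ _ → 1)

weightGF-++ : ∀ {A : Set} (E F : ℕ → List A) w → weightGF w (λ n → E n ++ F n) ≈ weightGF w E ⊕ weightGF w F
weightGF-++ E F w n = trans (cong ℚof (total-++ w (E n) (F n))) (ℚof-+ (total w (E n)) (total w (F n)))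

weightGF-+ : ∀ {A : Set} (u v : A → ℕ) E → weightGF (λ x → u x ℕ.+ v x) E ≈ weightGF u E ⊕ weightGF v E
weightGF-+ u v E n = trans (cong ℚof (total-+ u v (E n))) (ℚof-+ (total u (E n)) (total v (E n)))

Sized : ∀ {A : Set} → (A → ℕ) → (ℕ → List A) → Set
Sized size E = ∀ {n x} → x ∈ E n → size x ≡ n

++-sized : ∀ {A : Set} {s : A → ℕ} (E F : ℕ → List A) → Sized s E → Sized s F → Sized s (λ n → E n ++ F n)
++-sized E F E-sized F-sized {n} x∈ with ∈-++⁻ (E n) x∈
... | inj₁ x∈E = E-sized x∈E
... | inj₂ x∈F = F-sized x∈F

∈-⋆⁺ : ∀ {A B C : Set} (E : ℕ → List A) (c : A → B → C) (F : ℕ → List B) {i j x y} →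
       x ∈ E i → y ∈ F j → c x y ∈ (E ⋆⟨ c ⟩ F) (i ℕ.+ j)
∈-⋆⁺ E c F {i} {j} x∈ y∈ = ∈-concatMap⁺ (λ k → cartesianProductWith c (E k) (F (i ℕ.+ j ∸ k)))
  (lose (∈-upTo⁺ (s≤s (ℕP.m≤m+n i j)))
        (∈-cartesianProductWith⁺ c x∈ (subst (λ m → _ ∈ F m) (sym (ℕP.m+n∸m≡n i j)) y∈)))

module _ {A B C : Set} (E : ℕ → List A) (c : A → B → C) (F : ℕ → List B) where

  ∈-⋆⁻ : ∀ {n z} → z ∈ (E ⋆⟨ c ⟩ F) n →
         ∃ λ k → k ≤ n × ∃₂ λ x y → x ∈ E k × y ∈ F (n ∸ k) × z ≡ c x y
  ∈-⋆⁻ {n} z∈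
    with find (∈-concatMap⁻ (λ k → cartesianProductWith c (E k) (F (n ∸ k))) {xs = upTo (suc n)} z∈)
  ... | k , k∈ , z∈block = k , ℕP.≤-pred (∈-upTo⁻ k∈) , ∈-cartesianProductWith⁻ c (E k) (F (n ∸ k)) z∈block

  ⋆-sized : ∀ {s : A → ℕ} {t : B → ℕ} {r : C → ℕ} → (∀ x y → r (c x y) ≡ s x ℕ.+ t y) →
            Sized s E → Sized t F → Sized r (E ⋆⟨ c ⟩ F)
  ⋆-sized r≡s+t E-sized F-sized z∈ with ∈-⋆⁻ z∈
  ... | k , k≤n , x , y , x∈ , y∈ , refl =
    trans (r≡s+t x y) (trans (cong₂ ℕ._+_ (E-sized x∈) (F-sized y∈)) (ℕP.m+[n∸m]≡n k≤n))

  ⋆-unique : ∀ {s : A → ℕ} → (∀ {x x′ y y′} → c x y ≡ c x′ y′ → x ≡ x′ × y ≡ y′) →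
             Sized s E → (∀ n → Unique (E n)) → (∀ n → Unique (F n)) → ∀ n → Unique ((E ⋆⟨ c ⟩ F) n)
  ⋆-unique {s} c-injective E-sized E! F! n = Unique.concat⁺
    (All.map⁺ (All.universal (λ k → Unique.cartesianProductWith⁺ c c-injective (E! k) (F! (n ∸ k))) _))
    (AllPairs.map⁺ (AllPairs.map blocks-disjoint (Unique.upTo⁺ (suc n))))
    where
    blocks-disjoint : ∀ {i j} → i ≢ j →
      Disjoint (cartesianProductWith c (E i) (F (n ∸ i))) (cartesianProductWith c (E j) (F (n ∸ j)))
    blocks-disjoint {i} {j} i≢j (z∈i , z∈j)
      with ∈-cartesianProductWith⁻ c (E i) (F (n ∸ i)) z∈i | ∈-cartesianProductWith⁻ c (E j) (F (n ∸ j)) z∈j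
    ... | x , _ , x∈ , _ , refl | x′ , _ , x′∈ , _ , c-x≡c-x′ =
      i≢j (trans (sym (E-sized x∈)) (trans (cong s (proj₁ (c-injective c-x≡c-x′))) (E-sized x′∈)))

  countGF-⋆ : countGF (E ⋆⟨ c ⟩ F) ≈ countGF E ⊛ countGF F
  countGF-⋆ n = begin
    ℚof (count ((E ⋆⟨ c ⟩ F) n))
      ≡⟨ cong ℚof (total-concatMap (λ _ → 1) block (upTo (suc n))) ⟩
    ℚof (sumℕ (map (λ k → count (block k)) (upTo (suc n))))
      ≡⟨ cong (ℚof ∘ sumℕ)
           (List.map-cong (λ k → count-cartesianProductWith c (E k) (F (n ∸ k))) (upTo (suc n))) ⟩
    ℚof (sumℕ (map (λ k → count (E k) ℕ.* count (F (n ∸ k))) (upTo (suc n))))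
      ≡⟨ ℚof-convolution (count ∘ E) (count ∘ F) n ⟩
    (countGF E ⊛ countGF F) n ∎
    where
    open ≡-Reasoning
    block : ℕ → List C
    block k = cartesianProductWith c (E k) (F (n ∸ k))

  weightGF-⋆ : ∀ {w u v} → (∀ x y → w (c x y) ≡ u x ℕ.+ v y) →
    weightGF w (E ⋆⟨ c ⟩ F) ≈ weightGF u E ⊛ countGF F ⊕ countGF E ⊛ weightGF v F
  weightGF-⋆ {w} {u} {v} w≡u+v n = begin
    ℚof (total w ((E ⋆⟨ c ⟩ F) n))
      ≡⟨ cong ℚof (total-concatMap w block (upTo (suc n))) ⟩
    ℚof (sumℕ (map (λ k → total w (block k)) (upTo (suc n))))
      ≡⟨ cong (ℚof ∘ sumℕ)
           (List.map-cong (λ k → total-cartesianProductWith c w≡u+v (E k) (F (n ∸ k))) (upTo (suc n))) ⟩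
    ℚof (total (λ k → a k ℕ.+ b k) (upTo (suc n)))
      ≡⟨ cong ℚof (total-+ a b (upTo (suc n))) ⟩
    ℚof (total a (upTo (suc n)) ℕ.+ total b (upTo (suc n)))
      ≡⟨ ℚof-+ (total a (upTo (suc n))) (total b (upTo (suc n))) ⟩
    ℚof (total a (upTo (suc n))) ℚ.+ ℚof (total b (upTo (suc n)))
      ≡⟨ cong₂ ℚ._+_ (ℚof-convolution (total u ∘ E) (count ∘ F) n)
                     (ℚof-convolution (count ∘ E) (total v ∘ F) n) ⟩
    (weightGF u E ⊛ countGF F ⊕ countGF E ⊛ weightGF v F) n ∎
    where
    open ≡-Reasoning
    block : ℕ → List C
    block k = cartesianProductWith c (E k) (F (n ∸ k))
    a b : ℕ → ℕ
    a k = total u (E k) ℕ.* count (F (n ∸ k))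
    b k = count (E k) ℕ.* total v (F (n ∸ k))

-- Schroeder trees and forests

leafAt : ℕ → List STree
leafAt 1 = leaf ∷ []
leafAt _ = []

emptyAt : ℕ → List (List STree)
emptyAt 0 = [] ∷ []
emptyAt _ = []

-- trees f n and forests f n list the trees and forests with n leaves; the fuel f bounds the
-- nesting depth, and the lists are complete once n ≤ f, resp. n < f.
mutual
  trees : ℕ → ℕ → List STree
  trees zero    _ = []
  trees (suc f) n = leafAt n ++ (pairs f ⋆⟨ uncurry node ⟩ forests f) n

  pairs : ℕ → ℕ → List (STree × STree)
  pairs f = trees f ⋆⟨ _,_ ⟩ trees f

  forests : ℕ → ℕ → List (List STree)
  forests zero    _ = []
  forests (suc f) n = emptyAt n ++ (trees f ⋆⟨ _∷_ ⟩ forests f) n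

pairLeaves : STree × STree → ℕ
pairLeaves (a , b) = leaves a ℕ.+ leaves b

leafAt-sized : Sized leaves leafAt
leafAt-sized {1} (here refl) = refl

emptyAt-sized : Sized leavesL emptyAt
emptyAt-sized {0} (here refl) = refl

mutual
  trees-sized : ∀ f → Sized leaves (trees f)
  trees-sized (suc f) = ++-sized leafAt (pairs f ⋆⟨ uncurry node ⟩ forests f) leafAt-sized
    (⋆-sized (pairs f) (uncurry node) (forests f) {r = leaves} (λ _ _ → refl) (pairs-sized f) (forests-sized f))

  pairs-sized : ∀ f → Sized pairLeaves (pairs f)
  pairs-sized f = ⋆-sized (trees f) _,_ (trees f) (λ _ _ → refl) (trees-sized f) (trees-sized f)

  forests-sized : ∀ f → Sized leavesL (forests f)
  forests-sized (suc f) = ++-sized emptyAt (trees f ⋆⟨ _∷_ ⟩ forests f) emptyAt-sized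
    (⋆-sized (trees f) _∷_ (forests f) {r = leavesL} (λ _ _ → refl) (trees-sized f) (forests-sized f))

leaves-positive : ∀ t → 0 < leaves t
leaves-positive leaf          = s≤s z≤n
leaves-positive (node a b ts) =
  ℕP.<-≤-trans (leaves-positive a) (ℕP.≤-trans (ℕP.m≤m+n (leaves a) (leaves b)) (ℕP.m≤m+n _ (leavesL ts)))

mutual
  trees-complete : ∀ {f} t → leaves t ≤ f → t ∈ trees f (leaves t)
  trees-complete {zero}  t    t≤0 = contradiction (ℕP.<-≤-trans (leaves-positive t) t≤0) (λ ())
  trees-complete {suc f} leaf _   = here refl
  trees-complete {suc f} (node a b ts) t≤1+f = ∈-++⁺ʳ (leafAt (leaves (node a b ts)))
    (∈-⋆⁺ (pairs f) (uncurry node) (forests f)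
      (∈-⋆⁺ (trees f) _,_ (trees f) (trees-complete a (shrink a<t)) (trees-complete b (shrink b<t)))
      (forests-complete ts (shrink ts<t)))
    where
    shrink : ∀ {m} → m < leaves (node a b ts) → m ≤ f
    shrink m<t = ℕP.≤-pred (ℕP.<-≤-trans m<t t≤1+f)
    a<t : leaves a < leaves (node a b ts)
    a<t = ℕP.<-≤-trans (ℕP.m<m+n (leaves a) (leaves-positive b)) (ℕP.m≤m+n _ (leavesL ts))
    b<t : leaves b < leaves (node a b ts)
    b<t = ℕP.<-≤-trans (ℕP.m<n+m (leaves b) (leaves-positive a)) (ℕP.m≤m+n _ (leavesL ts))
    ts<t : suc (leavesL ts) < leaves (node a b ts)
    ts<t = ℕP.+-monoˡ-≤ (leavesL ts) (ℕP.+-mono-≤ (leaves-positive a) (leaves-positive b))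

  forests-complete : ∀ {f} ts → leavesL ts < f → ts ∈ forests f (leavesL ts)
  forests-complete {suc f} []       _      = here refl
  forests-complete {suc f} (t ∷ ts) ts<1+f = ∈-++⁺ʳ (emptyAt (leavesL (t ∷ ts)))
    (∈-⋆⁺ (trees f) _∷_ (forests f)
      (trees-complete t (ℕP.≤-trans (ℕP.m≤m+n (leaves t) (leavesL ts)) (ℕP.≤-pred ts<1+f)))
      (forests-complete ts (ℕP.<-≤-trans (ℕP.m<n+m (leavesL ts) (leaves-positive t)) (ℕP.≤-pred ts<1+f))))

leafAt-unique : ∀ n → Unique (leafAt n)
leafAt-unique 0             = []
leafAt-unique 1             = [] ∷ []
leafAt-unique (suc (suc n)) = []

emptyAt-unique : ∀ n → Unique (emptyAt n)
emptyAt-unique 0       = [] ∷ []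
emptyAt-unique (suc n) = []

uncurry-node-injective : ∀ {p q : STree × STree} {ts us} →
                         uncurry node p ts ≡ uncurry node q us → p ≡ q × ts ≡ us
uncurry-node-injective refl = refl , refl

mutual
  trees-unique : ∀ f n → Unique (trees f n)
  trees-unique zero    n = []
  trees-unique (suc f) n = Unique.++⁺ (leafAt-unique n)
    (⋆-unique (pairs f) (uncurry node) (forests f) uncurry-node-injective (pairs-sized f)
      (pairs-unique f) (forests-unique f) n)
    leaf∉nodes
    where
    leaf∉nodes : ∀ {n} → Disjoint (leafAt n) ((pairs f ⋆⟨ uncurry node ⟩ forests f) n)
    leaf∉nodes {1} (here refl , leaf∈nodes) with ∈-⋆⁻ (pairs f) (uncurry node) (forests f) leaf∈nodes
    ... | _ , _ , _ , _ , _ , _ , ()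

  pairs-unique : ∀ f n → Unique (pairs f n)
  pairs-unique f = ⋆-unique (trees f) _,_ (trees f) ,-injective (trees-sized f) (trees-unique f) (trees-unique f)

  forests-unique : ∀ f n → Unique (forests f n)
  forests-unique zero    n = []
  forests-unique (suc f) n = Unique.++⁺ (emptyAt-unique n)
    (⋆-unique (trees f) _∷_ (forests f) List.∷-injective (trees-sized f) (trees-unique f) (forests-unique f) n)
    []∉conses
    where
    []∉conses : ∀ {n} → Disjoint (emptyAt n) ((trees f ⋆⟨ _∷_ ⟩ forests f) n)
    []∉conses {0} (here refl , []∈conses) with ∈-⋆⁻ (trees f) _∷_ (forests f) []∈conses
    ... | _ , _ , _ , _ , _ , _ , ()

∈-trees⇔ : ∀ {f n t} → n ≤ f → t ∈ trees f n ⇔ leaves t ≡ n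
∈-trees⇔ {f} {n} {t} n≤f = mk⇔ (trees-sized f) complete
  where
  complete : leaves t ≡ n → t ∈ trees f n
  complete t≡n = subst (λ m → t ∈ trees f m) t≡n (trees-complete t (subst (_≤ f) (sym t≡n) n≤f))

∈-forests⇔ : ∀ {f n ts} → n < f → ts ∈ forests f n ⇔ leavesL ts ≡ n
∈-forests⇔ {f} {n} {ts} n<f = mk⇔ (forests-sized f) complete
  where
  complete : leavesL ts ≡ n → ts ∈ forests f n
  complete ts≡n = subst (λ m → ts ∈ forests f m) ts≡n (forests-complete ts (subst (_< f) (sym ts≡n) n<f))

-- Functional equations

treeGF : (STree → ℕ) → FPS
treeGF w n = weightGF w (trees (suc n)) n

forestGF : (List STree → ℕ) → FPS
forestGF w n = weightGF w (forests (suc n)) n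

trees-stable : ∀ w {f n} → n ≤ f → weightGF w (trees f) n ≡ treeGF w n
trees-stable w {f} {n} n≤f = cong ℚof (total-unique w (trees-unique f n) (trees-unique (suc n) n)
  (⇔.trans (∈-trees⇔ n≤f) (⇔.sym (∈-trees⇔ (ℕP.n≤1+n _)))))

forests-stable : ∀ w {f n} → n < f → weightGF w (forests f) n ≡ forestGF w n
forests-stable w {f} {n} n<f = cong ℚof (total-unique w (forests-unique f n) (forests-unique (suc n) n)
  (⇔.trans (∈-forests⇔ n<f) (⇔.sym (∈-forests⇔ ℕP.≤-refl))))

trees-approx : ∀ w n → weightGF w (trees (suc n)) ≈[≤ n ] treeGF w
trees-approx w n k≤n = trees-stable w (ℕP.m≤n⇒m≤1+n k≤n)

forests-approx : ∀ w n → weightGF w (forests (suc n)) ≈[≤ n ] forestGF w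
forests-approx w n k≤n = forests-stable w (s≤s k≤n)

-- Coefficient n is read off at fuel n + 2, where the approximations inside Φ (n + 1) are
-- already exact.
limit : ∀ (G : ℕ → FPS) {Φ : ℕ → FPS} {g φ : FPS} → (∀ n → G (suc (suc n)) n ≡ g n) →
        (∀ f → G (suc f) ≈ Φ f) → (∀ n → Φ (suc n) ≈[≤ n ] φ) → g ≈ φ
limit G stable step approx n = trans (sym (stable n)) (trans (step (suc n) n) (approx n ℕP.≤-refl))

trees-limit : ∀ w {Φ : ℕ → FPS} {φ} → (∀ f → weightGF w (trees (suc f)) ≈ Φ f) →
              (∀ n → Φ (suc n) ≈[≤ n ] φ) → treeGF w ≈ φ
trees-limit w = limit (weightGF w ∘ trees) (λ n → trees-stable w (ℕP.m≤n+m n 2))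

forests-limit : ∀ w {Φ : ℕ → FPS} {φ} → (∀ f → weightGF w (forests (suc f)) ≈ Φ f) →
                (∀ n → Φ (suc n) ≈[≤ n ] φ) → forestGF w ≈ φ
forests-limit w = limit (weightGF w ∘ forests) (λ n → forests-stable w (ℕP.m<n⇒m<1+n (ℕP.n<1+n n)))

weightGF-leafAt : ∀ (w : STree → ℕ) → w leaf ≡ 1 → weightGF w leafAt ≈ X
weightGF-leafAt w w-leaf≡1 0             = refl
weightGF-leafAt w w-leaf≡1 1             = cong (λ m → ℚof (m ℕ.+ 0)) w-leaf≡1
weightGF-leafAt w w-leaf≡1 (suc (suc n)) = refl

weightGF-emptyAt : ∀ (w : List STree → ℕ) → weightGF w emptyAt ≈ const (ℚof (w []))
weightGF-emptyAt w 0       = cong ℚof (ℕP.+-identityʳ (w []))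
weightGF-emptyAt w (suc n) = refl

pairVertices : STree × STree → ℕ
pairVertices (a , b) = vertices a ℕ.+ vertices b

module _ (f : ℕ) where

  private
    T F V W : FPS
    T = countGF (trees f)
    F = countGF (forests f)
    V = weightGF vertices (trees f)
    W = weightGF verticesL (forests f)

  open SetoidReasoning FPS.setoid

  countGF-pairs : countGF (pairs f) ≈ T ⊛ T
  countGF-pairs = countGF-⋆ (trees f) _,_ (trees f)

  countGF-trees-suc : countGF (trees (suc f)) ≈ X ⊕ T ⊛ T ⊛ F
  countGF-trees-suc = begin
    countGF (trees (suc f))
      ≈⟨ weightGF-++ leafAt (pairs f ⋆⟨ uncurry node ⟩ forests f) (λ _ → 1) ⟩
    countGF leafAt ⊕ countGF (pairs f ⋆⟨ uncurry node ⟩ forests f)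
      ≈⟨ FPS.+-cong (weightGF-leafAt (λ _ → 1) refl) (countGF-⋆ (pairs f) (uncurry node) (forests f)) ⟩
    X ⊕ countGF (pairs f) ⊛ F
      ≈⟨ ⊕-congˡ X (⊛-congʳ F countGF-pairs) ⟩
    X ⊕ T ⊛ T ⊛ F ∎

  countGF-forests-suc : countGF (forests (suc f)) ≈ 1ˢ ⊕ T ⊛ F
  countGF-forests-suc = begin
    countGF (forests (suc f))
      ≈⟨ weightGF-++ emptyAt (trees f ⋆⟨ _∷_ ⟩ forests f) (λ _ → 1) ⟩
    countGF emptyAt ⊕ countGF (trees f ⋆⟨ _∷_ ⟩ forests f)
      ≈⟨ FPS.+-cong (weightGF-emptyAt (λ _ → 1)) (countGF-⋆ (trees f) _∷_ (forests f)) ⟩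
    1ˢ ⊕ T ⊛ F ∎

  verticesGF-trees-suc : weightGF vertices (trees (suc f)) ≈ X ⊕ ((T ⊛ T ⊕ (V ⊛ T ⊕ T ⊛ V)) ⊛ F ⊕ T ⊛ T ⊛ W)
  verticesGF-trees-suc = begin
    weightGF vertices (trees (suc f))
      ≈⟨ weightGF-++ leafAt (pairs f ⋆⟨ uncurry node ⟩ forests f) vertices ⟩
    weightGF vertices leafAt ⊕ weightGF vertices (pairs f ⋆⟨ uncurry node ⟩ forests f)
      ≈⟨ FPS.+-cong (weightGF-leafAt vertices refl)
           -- the root of a node is counted together with its first two subtrees
           (weightGF-⋆ (pairs f) (uncurry node) (forests f) {u = suc ∘ pairVertices} (λ _ _ → refl)) ⟩
    X ⊕ (weightGF (suc ∘ pairVertices) (pairs f) ⊛ F ⊕ countGF (pairs f) ⊛ W)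
      ≈⟨ ⊕-congˡ X (FPS.+-cong (⊛-congʳ F pairs-with-root) (⊛-congʳ W countGF-pairs)) ⟩
    X ⊕ ((T ⊛ T ⊕ (V ⊛ T ⊕ T ⊛ V)) ⊛ F ⊕ T ⊛ T ⊛ W) ∎
    where
    pairs-with-root : weightGF (suc ∘ pairVertices) (pairs f) ≈ T ⊛ T ⊕ (V ⊛ T ⊕ T ⊛ V)
    pairs-with-root = FPS.trans (weightGF-+ (λ _ → 1) pairVertices (pairs f))
      (FPS.+-cong countGF-pairs (weightGF-⋆ (trees f) _,_ (trees f) (λ _ _ → refl)))

  verticesGF-forests-suc : weightGF verticesL (forests (suc f)) ≈ V ⊛ F ⊕ T ⊛ W
  verticesGF-forests-suc = begin
    weightGF verticesL (forests (suc f))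
      ≈⟨ weightGF-++ emptyAt (trees f ⋆⟨ _∷_ ⟩ forests f) verticesL ⟩
    weightGF verticesL emptyAt ⊕ weightGF verticesL (trees f ⋆⟨ _∷_ ⟩ forests f)
      ≈⟨ FPS.+-cong (FPS.trans (weightGF-emptyAt verticesL) const-0)
                    (weightGF-⋆ (trees f) _∷_ (forests f) (λ _ _ → refl)) ⟩
    0ˢ ⊕ (V ⊛ F ⊕ T ⊛ W)
      ≈⟨ FPS.+-identityˡ (V ⊛ F ⊕ T ⊛ W) ⟩
    V ⊛ F ⊕ T ⊛ W ∎

treeCount forestCount treeVertices forestVertices : FPS
treeCount      = treeGF (λ _ → 1)
forestCount    = forestGF (λ _ → 1)
treeVertices   = treeGF vertices
forestVertices = forestGF verticesL

treeCount-approx : ∀ n → countGF (trees (suc n)) ≈[≤ n ] treeCount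
treeCount-approx = trees-approx (λ _ → 1)

forestCount-approx : ∀ n → countGF (forests (suc n)) ≈[≤ n ] forestCount
forestCount-approx = forests-approx (λ _ → 1)

treeVertices-approx : ∀ n → weightGF vertices (trees (suc n)) ≈[≤ n ] treeVertices
treeVertices-approx = trees-approx vertices

forestVertices-approx : ∀ n → weightGF verticesL (forests (suc n)) ≈[≤ n ] forestVertices
forestVertices-approx = forests-approx verticesL

treeCount-equation : treeCount ≈ X ⊕ treeCount ⊛ treeCount ⊛ forestCount
treeCount-equation = trees-limit (λ _ → 1) countGF-trees-suc λ n →
  let T≈ = treeCount-approx n ; F≈ = forestCount-approx n in
  ⊕-cong-≤ {f = X} (λ _ → refl) (⊛-cong-≤ (⊛-cong-≤ T≈ T≈) F≈)

forestCount-equation : forestCount ≈ 1ˢ ⊕ treeCount ⊛ forestCount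
forestCount-equation = forests-limit (λ _ → 1) countGF-forests-suc λ n →
  ⊕-cong-≤ {f = 1ˢ} (λ _ → refl) (⊛-cong-≤ (treeCount-approx n) (forestCount-approx n))

treeVertices-equation :
  treeVertices ≈ X ⊕ ((treeCount ⊛ treeCount ⊕ (treeVertices ⊛ treeCount ⊕ treeCount ⊛ treeVertices)) ⊛ forestCount
                      ⊕ treeCount ⊛ treeCount ⊛ forestVertices)
treeVertices-equation = trees-limit vertices verticesGF-trees-suc λ n →
  let T≈ = treeCount-approx n ; F≈ = forestCount-approx n
      V≈ = treeVertices-approx n ; W≈ = forestVertices-approx n in
  ⊕-cong-≤ {f = X} (λ _ → refl) (⊕-cong-≤
    (⊛-cong-≤ (⊕-cong-≤ (⊛-cong-≤ T≈ T≈) (⊕-cong-≤ (⊛-cong-≤ V≈ T≈) (⊛-cong-≤ T≈ V≈))) F≈)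
    (⊛-cong-≤ (⊛-cong-≤ T≈ T≈) W≈))

forestVertices-equation : forestVertices ≈ treeVertices ⊛ forestCount ⊕ treeCount ⊛ forestVertices
forestVertices-equation = forests-limit verticesL verticesGF-forests-suc λ n →
  ⊕-cong-≤ (⊛-cong-≤ (treeVertices-approx n) (forestCount-approx n))
           (⊛-cong-≤ (treeCount-approx n) (forestVertices-approx n))

Vseries≈treeVertices : ∀ enum → (∀ n t → (t ∈ enum n) ⇔ (leaves t ≡ n)) → (∀ n → Unique (enum n)) →
                       Vseries enum ≈ treeVertices
Vseries≈treeVertices enum ∈enum⇔ enum! n = cong ℚof (total-unique vertices (enum! n) (trees-unique (suc n) n)
  (⇔.trans (∈enum⇔ n _) (⇔.sym (∈-trees⇔ (ℕP.n≤1+n n)))))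

-- Solving the equations

open FPS-Solver using (solve; _:=_; con; _:+_; _:*_; _:-_; :-_)

schroeder : FPS → FPS
schroeder t = const (ℚof 2) ⊛ t ⊛ t ⊖ (1ˢ ⊕ X) ⊛ t ⊕ X

root : FPS → FPS
root t = 1ˢ ⊕ X ⊖ const (ℚof 4) ⊛ t

quadratic : ∀ {t f} → t ≈ X ⊕ t ⊛ t ⊛ f → f ≈ 1ˢ ⊕ t ⊛ f → schroeder t ≈ 0ˢ
quadratic {t} {f} t-eq f-eq = FPS.trans
  (solve 3 (λ t f x → con (ℚof 2) :* t :* t :- (con 1ℚ :+ x) :* t :+ x
                   := (t :- con 1ℚ) :* (t :- (x :+ t :* t :* f)) :+ :- (t :* t) :* (f :- (con 1ℚ :+ t :* f)))
     (λ _ → refl) t f X)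
  (vanishes (t ⊖ 1ˢ) t-eq ⊞ vanishes (neg (t ⊛ t)) f-eq)

root-squared : ∀ {t} → schroeder t ≈ 0ˢ → root t ⊛ root t ≈ P
root-squared {t} q≈0 = linear-combination (vanishes₀ (const (ℚof 8)) q≈0)
  (solve 2 (λ t x → (con 1ℚ :+ x :- con (ℚof 4) :* t) :* (con 1ℚ :+ x :- con (ℚof 4) :* t)
                  := con 1ℚ :- con (ℚof 6) :* x :+ x :* x
                     :+ con (ℚof 8) :* (con (ℚof 2) :* t :* t :- (con 1ℚ :+ x) :* t :+ x))
     (λ _ → refl) t X)

root-constant : ∀ {t} → t 0 ≡ 0ℚ → root t 0 ≡ 1ℚ
root-constant t₀≡0 = cong (λ a → 1ℚ ℚ.+ 0ℚ ℚ.- (ℚof 4 ℚ.* a ℚ.+ 0ℚ)) t₀≡0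

square-root-unique : ∀ {s r} → s ⊛ s ≈ r ⊛ r → s 0 ≡ r 0 → r 0 ≢ 0ℚ → s ≈ r
square-root-unique {s} {r} s²≈r² s₀≡r₀ r₀≢0 = linear-combination
  (f⊛g≈0⇒f≈0 {g = s ⊕ r} (λ s₀+r₀≡0 → r₀≢0 (p+p≡0⇒p≡0 (r 0) (trans (cong (ℚ._+ r 0) (sym s₀≡r₀)) s₀+r₀≡0)))
    (FPS.trans (solve 2 (λ s r → (s :- r) :* (s :+ r) := con 1ℚ :* (s :* s :- r :* r)) (λ _ → refl) s r)
               (vanishes 1ˢ s²≈r²)))
  (solve 2 (λ s r → s := r :+ (s :- r)) (λ _ → refl) s r)

-- Multiply the vertex equation by (1 − t)², then use f(1 − t) = 1 and w(1 − t) = vf.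
vertex-relation : ∀ {t f v w} → f ≈ 1ˢ ⊕ t ⊛ f → w ≈ v ⊛ f ⊕ t ⊛ w →
  v ≈ X ⊕ ((t ⊛ t ⊕ (v ⊛ t ⊕ t ⊛ v)) ⊛ f ⊕ t ⊛ t ⊛ w) →
  v ⊛ (1ˢ ⊖ const (ℚof 4) ⊛ t ⊕ const (ℚof 2) ⊛ t ⊛ t) ≈ (1ˢ ⊖ t) ⊛ (X ⊛ (1ˢ ⊖ t) ⊕ t ⊛ t)
vertex-relation {t} {f} {v} {w} f-eq w-eq v-eq = linear-combination
  (vanishes ((1ˢ ⊖ t) ⊛ (1ˢ ⊖ t)) v-eq
   ⊞ vanishes ((t ⊛ t ⊕ const (ℚof 2) ⊛ t ⊛ v) ⊛ (1ˢ ⊖ t) ⊕ t ⊛ t ⊛ v) f-eq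
   ⊞ vanishes (t ⊛ t ⊛ (1ˢ ⊖ t)) w-eq)
  (solve 5 (λ t f v w x →
       v :* (con 1ℚ :- con (ℚof 4) :* t :+ con (ℚof 2) :* t :* t)
    := (con 1ℚ :- t) :* (x :* (con 1ℚ :- t) :+ t :* t)
       :+ ((con 1ℚ :- t) :* (con 1ℚ :- t) :* (v :- (x :+ ((t :* t :+ (v :* t :+ t :* v)) :* f :+ t :* t :* w)))
           :+ ((t :* t :+ con (ℚof 2) :* t :* v) :* (con 1ℚ :- t) :+ t :* t :* v) :* (f :- (con 1ℚ :+ t :* f))
           :+ t :* t :* (con 1ℚ :- t) :* (w :- (v :* f :+ t :* w))))
     (λ _ → refl) t f v w X)

-- (1 − t)(v · root t − t(1 − t)) is the defect of the relation plus (v + 1 − t) · schroeder t,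
-- and the factor 1 − t is cancelled by its inverse f.
vertex-closed-form : ∀ {t f v} → f ≈ 1ˢ ⊕ t ⊛ f → schroeder t ≈ 0ˢ →
  v ⊛ (1ˢ ⊖ const (ℚof 4) ⊛ t ⊕ const (ℚof 2) ⊛ t ⊛ t) ≈ (1ˢ ⊖ t) ⊛ (X ⊛ (1ˢ ⊖ t) ⊕ t ⊛ t) →
  v ⊛ root t ≈ t ⊛ (1ˢ ⊖ t)
vertex-closed-form {t} {f} {v} f-eq q≈0 relation = linear-combination
  (vanishes f relation
   ⊞ vanishes₀ (f ⊛ (v ⊕ 1ˢ ⊖ t)) q≈0
   ⊞ vanishes (neg (v ⊛ root t ⊖ t ⊛ (1ˢ ⊖ t))) f-eq)
  (solve 4 (λ t f v x →
       v :* (con 1ℚ :+ x :- con (ℚof 4) :* t)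
    := t :* (con 1ℚ :- t)
       :+ (f :* (v :* (con 1ℚ :- con (ℚof 4) :* t :+ con (ℚof 2) :* t :* t)
                 :- (con 1ℚ :- t) :* (x :* (con 1ℚ :- t) :+ t :* t))
           :+ f :* (v :+ con 1ℚ :- t) :* (con (ℚof 2) :* t :* t :- (con 1ℚ :+ x) :* t :+ x)
           :+ :- (v :* (con 1ℚ :+ x :- con (ℚof 4) :* t) :- t :* (con 1ℚ :- t)) :* (f :- (con 1ℚ :+ t :* f))))
     (λ _ → refl) t f v X)

tree-closed-form : ∀ {t s b} → schroeder t ≈ 0ˢ → s ≈ root t → b ⊛ (1ˢ ⊕ X ⊕ s) ≈ 1ˢ →
  t ≈ const (ℚof 2) ⊛ X ⊛ b
tree-closed-form {t} {s} {b} q≈0 s≈root b-inverse = linear-combination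
  (vanishes (t ⊛ b) s≈root ⊞ vanishes (neg t) b-inverse ⊞ vanishes₀ (neg (const (ℚof 2) ⊛ b)) q≈0)
  (solve 4 (λ t s b x →
       t
    := con (ℚof 2) :* x :* b
       :+ (t :* b :* (s :- (con 1ℚ :+ x :- con (ℚof 4) :* t))
           :+ :- t :* (b :* (con 1ℚ :+ x :+ s) :- con 1ℚ)
           :+ :- (con (ℚof 2) :* b) :* (con (ℚof 2) :* t :* t :- (con 1ℚ :+ x) :* t :+ x)))
     (λ _ → refl) t s b X)

vertex-series-closed-form : ∀ {t v s a b} → v ⊛ root t ≈ t ⊛ (1ˢ ⊖ t) → s ≈ root t →
  a ⊛ (const (ℚof 4) ⊛ s) ≈ 1ˢ → t ≈ const (ℚof 2) ⊛ X ⊛ b →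
  v ≈ ((const (ℚof 3) ⊖ X ⊕ s) ⊛ a) ⊛ ((const (ℚof 2) ⊛ X) ⊛ b)
vertex-series-closed-form {t} {v} {s} {a} {b} v-root s≈root a-inverse t≈2xb = linear-combination
  (vanishes (neg v) a-inverse ⊞ vanishes (const (ℚof 4) ⊛ a) v-root
   ⊞ vanishes (const (ℚof 4) ⊛ a ⊛ v ⊖ a ⊛ t) s≈root ⊞ vanishes (a ⊛ (const (ℚof 3) ⊖ X ⊕ s)) t≈2xb)
  (solve 6 (λ t v s a b x →
       v
    := (con (ℚof 3) :- x :+ s) :* a :* (con (ℚof 2) :* x :* b)
       :+ (:- v :* (a :* (con (ℚof 4) :* s) :- con 1ℚ)
           :+ con (ℚof 4) :* a :* (v :* (con 1ℚ :+ x :- con (ℚof 4) :* t) :- t :* (con 1ℚ :- t))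
           :+ (con (ℚof 4) :* a :* v :- a :* t) :* (s :- (con 1ℚ :+ x :- con (ℚof 4) :* t))
           :+ a :* (con (ℚof 3) :- x :+ s) :* (t :- con (ℚof 2) :* x :* b)))
     (λ _ → refl) t v s a b X)

mainTheorem9 :
    (enum : ℕ → List STree) →
    (∀ n t → (t ∈ enum n) ⇔ (leaves t ≡ n)) →
    (∀ n → Unique (enum n)) →
    (S : FPS) → S 0 ≡ 1ℚ → S ⊛ S ≈ P →
    (A : FPS) → A ⊛ (const (ℚof 4) ⊛ S) ≈ const 1ℚ →
    (B : FPS) → B ⊛ (const 1ℚ ⊕ X ⊕ S) ≈ const 1ℚ →
    Vseries enum ≈ ((const (ℚof 3) ⊖ X ⊕ S) ⊛ A) ⊛ ((const (ℚof 2) ⊛ X) ⊛ B)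
mainTheorem9 enum ∈enum⇔ enum! S S₀≡1 S²≈P A A-inverse B B-inverse =
  FPS.trans (Vseries≈treeVertices enum ∈enum⇔ enum!)
    (vertex-series-closed-form {treeCount} {treeVertices} {S} {A} {B} vertices-formula S≈root A-inverse
      (tree-closed-form {treeCount} {S} {B} q≈0 S≈root B-inverse))
  where
  q≈0 : schroeder treeCount ≈ 0ˢ
  q≈0 = quadratic {treeCount} {forestCount} treeCount-equation forestCount-equation
  root₀≡1 : root treeCount 0 ≡ 1ℚ
  root₀≡1 = root-constant {treeCount} refl
  S≈root : S ≈ root treeCount
  S≈root = square-root-unique {S} {root treeCount} (FPS.trans S²≈P (FPS.sym (root-squared {treeCount} q≈0)))
    (trans S₀≡1 (sym root₀≡1)) (λ root₀≡0 → contradiction (trans (sym root₀≡1) root₀≡0) λ ())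
  vertices-formula : treeVertices ⊛ root treeCount ≈ treeCount ⊛ (1ˢ ⊖ treeCount)
  vertices-formula = vertex-closed-form {treeCount} {forestCount} {treeVertices} forestCount-equation q≈0
    (vertex-relation {treeCount} {forestCount} {treeVertices} {forestVertices}
      forestCount-equation forestVertices-equation treeVertices-equation)
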